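{- Let $E\neq\emptyset$ be an equivalence relation, let $\underline{B}=\langle B,+,-,;,{}^\smile,1'\rangle$ be a nondegenerate algebra of the same similarity type as $\underline{\mathrm{Sb}}(E)$, and let $h:\underline{\mathrm{Sb}}(E)\to\underline{B}$ be a surjective homomorphism whose kernel is maximal. Define $\sigma:\mathrm{Sb}(E)\to\mathrm{Re}(\mathrm{Pt}_E)$ by $\sigma(R)=\{\langle p,q\rangle\in\mathrm{Pt}_E\times\mathrm{Pt}_E : h(E)=h(E|p|R|q|E)\}$. Then for all $R,S\subseteq E$: (i) $\sigma(\emptyset)=\emptyset$; (ii) $\sigma(E)=\mathrm{Pt}_E\times\mathrm{Pt}_E$; (iii) $R\subseteq S\Rightarrow\sigma(R)\subseteq\sigma(S)$; (iv) $\sigma(R\cup S)=\sigma(R)\cup\sigma(S)$; (v) $\sigma(E\setminus R)\cap\sigma(R)=\emptyset$; (vi) $\sigma(E\setminus R)\cup\sigma(R)=\mathrm{Pt}_E\times\mathrm{Pt}_E$, and consequently $\sigma(E\setminus R)=\sigma(E)\setminus\sigma(R)$; (vii) $\sigma(R|S)=\sigma(R)|\sigma(S)$; (viii) $\sigma(R^{ -1})=\sigma(R)^{ -1}$; (ix) $\sigma(\mathrm{Id}_E)\supseteq\mathrm{Id}\cap(\mathrm{Pt}_E\times\mathrm{Pt}_E)$.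
   Context: For binary relations, $R|S=\{\langle x,z\rangle:\exists y\,(\langle x,y\rangle\in R\wedge\langle y,z\rangle\in S)\}$, $R^{ -1}=\{\langle x,y\rangle:\langle y,x\rangle\in R\}$; $\mathrm{Id}$ is the identity relation and $\mathrm{Id}_E=\mathrm{Id}\cap E$. $\underline{\mathrm{Sb}}(E)=\langle \mathrm{Sb}(E),\cup,E\setminus(\cdot),|,{}^{ -1},\mathrm{Id}_E\rangle$, where $\mathrm{Sb}(E)$ is the power set of $E$; $\mathrm{Re}(X)$ is the power set of $X\times X$. $\mathrm{Pt}_E=\{p\subseteq E : E|p|E=E,\ p|E|p\subseteq\mathrm{Id}_E\}$. The kernel of $h$ being maximal means that the congruence $\{\langle R,S\rangle: h(R)=h(S)\}$ is a maximal proper congruence of $\underline{\mathrm{Sb}}(E)$ (equivalently, $h^{ -1}[\{h(\emptyset)\}]$ is a maximal proper ideal closed under $X\mapsto E|X|E$). -}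

module Defs where

open import Level using (Level; _⊔_; 0ℓ) renaming (suc to lsuc)
open import Data.Product using (Σ; ∃; ∃₂; _×_; _,_)
open import Data.Sum using (_⊎_)
open import Data.Empty using (⊥)
open import Relation.Nullary using (¬_)
open import Relation.Binary.PropositionalEquality using (_≡_; _≢_)

BRel : ∀ {a} → Set a → (ℓ : Level) → Set (a ⊔ lsuc ℓ)
BRel A ℓ = A → A → Set ℓ

Rel₀ : Set → Set₁
Rel₀ U = BRel U 0ℓ

module _ {a} {A : Set a} where

  infixl 7 _⨾_
  infixl 6 _∪ʳ_ _∩ʳ_ _∖ʳ_
  infix 4 _⊆ʳ_ _≐_

  _⊆ʳ_ : ∀ {ℓ₁ ℓ₂} → BRel A ℓ₁ → BRel A ℓ₂ → Set (a ⊔ ℓ₁ ⊔ ℓ₂)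
  R ⊆ʳ S = ∀ x y → R x y → S x y

  _≐_ : ∀ {ℓ₁ ℓ₂} → BRel A ℓ₁ → BRel A ℓ₂ → Set (a ⊔ ℓ₁ ⊔ ℓ₂)
  R ≐ S = (R ⊆ʳ S) × (S ⊆ʳ R)

  ∅ʳ : BRel A 0ℓ
  ∅ʳ x y = ⊥

  _∪ʳ_ : ∀ {ℓ₁ ℓ₂} → BRel A ℓ₁ → BRel A ℓ₂ → BRel A (ℓ₁ ⊔ ℓ₂)
  (R ∪ʳ S) x y = R x y ⊎ S x y

  _∩ʳ_ : ∀ {ℓ₁ ℓ₂} → BRel A ℓ₁ → BRel A ℓ₂ → BRel A (ℓ₁ ⊔ ℓ₂)
  (R ∩ʳ S) x y = R x y × S x y

  _∖ʳ_ : ∀ {ℓ₁ ℓ₂} → BRel A ℓ₁ → BRel A ℓ₂ → BRel A (ℓ₁ ⊔ ℓ₂)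
  (E ∖ʳ R) x y = E x y × ¬ R x y

  _⨾_ : ∀ {ℓ₁ ℓ₂} → BRel A ℓ₁ → BRel A ℓ₂ → BRel A (a ⊔ ℓ₁ ⊔ ℓ₂)
  (R ⨾ S) x z = ∃ λ y → R x y × S y z

  _⁻¹ʳ : ∀ {ℓ} → BRel A ℓ → BRel A ℓ
  (R ⁻¹ʳ) x y = R y x

  Idʳ : ∀ {ℓ} → BRel A ℓ → BRel A (a ⊔ ℓ)
  Idʳ E x y = (x ≡ y) × E x y


record RAlgebra : Set₁ where
  field
    Carrier : Set
    _+_     : Carrier → Carrier → Carrier
    -_      : Carrier → Carrier
    _︔_     : Carrier → Carrier → Carrier
    _˘      : Carrier → Carrier
    1'      : Carrier

Nondegenerate : RAlgebra → Set
Nondegenerate B = ∃₂ λ (a b : RAlgebra.Carrier B) → a ≢ b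

module _ {U : Set} (E : Rel₀ U) where

  InSb : Rel₀ U → Set
  InSb R = R ⊆ʳ E

  -- h : Sb(E) → B is a homomorphism (h is given on Rel₀ U, only its
  -- restriction to Sb(E) matters; it must be well defined on sets,
  -- i.e. respect extensional equality).
  record IsHom (B : RAlgebra) (h : Rel₀ U → RAlgebra.Carrier B) : Set₁ where
    open RAlgebra B
    field
      h-resp : ∀ R S → InSb R → InSb S → R ≐ S → h R ≡ h S
      h-∪    : ∀ R S → InSb R → InSb S → h (R ∪ʳ S) ≡ h R + h S
      h-∖    : ∀ R → InSb R → h (E ∖ʳ R) ≡ - h R
      h-⨾    : ∀ R S → InSb R → InSb S → h (R ⨾ S) ≡ h R ︔ h S
      h-⁻¹   : ∀ R → InSb R → h (R ⁻¹ʳ) ≡ h R ˘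
      h-Id   : h (Idʳ E) ≡ 1'

  Surjective : (B : RAlgebra) → (Rel₀ U → RAlgebra.Carrier B) → Set₁
  Surjective B h = ∀ b → Σ (Rel₀ U) λ R → InSb R × h R ≡ b

  record IsCongruence (Θ : Rel₀ U → Rel₀ U → Set) : Set₁ where
    field
      Θ-refl  : ∀ R S → InSb R → InSb S → R ≐ S → Θ R S
      Θ-sym   : ∀ R S → InSb R → InSb S → Θ R S → Θ S R
      Θ-trans : ∀ R S T → InSb R → InSb S → InSb T → Θ R S → Θ S T → Θ R T
      Θ-∪     : ∀ R R' S S' → InSb R → InSb R' → InSb S → InSb S' →
                Θ R R' → Θ S S' → Θ (R ∪ʳ S) (R' ∪ʳ S')
      Θ-∖     : ∀ R R' → InSb R → InSb R' → Θ R R' → Θ (E ∖ʳ R) (E ∖ʳ R')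
      Θ-⨾     : ∀ R R' S S' → InSb R → InSb R' → InSb S → InSb S' →
                Θ R R' → Θ S S' → Θ (R ⨾ S) (R' ⨾ S')
      Θ-⁻¹    : ∀ R R' → InSb R → InSb R' → Θ R R' → Θ (R ⁻¹ʳ) (R' ⁻¹ʳ)

  CongIncl : (Θ Θ' : Rel₀ U → Rel₀ U → Set) → Set₁
  CongIncl Θ Θ' = ∀ R S → InSb R → InSb S → Θ R S → Θ' R S

  TotalCong : (Θ : Rel₀ U → Rel₀ U → Set) → Set₁
  TotalCong Θ = ∀ R S → InSb R → InSb S → Θ R S

  ProperCong : (Θ : Rel₀ U → Rel₀ U → Set) → Set₁
  ProperCong Θ = Σ (Rel₀ U) λ R → Σ (Rel₀ U) λ S → InSb R × InSb S × ¬ Θ R S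

  record IsMaximalCongruence (Θ : Rel₀ U → Rel₀ U → Set) : Set₂ where
    field
      isCong  : IsCongruence Θ
      proper  : ProperCong Θ
      maximal : ∀ Θ' → IsCongruence Θ' → CongIncl Θ Θ' →
                CongIncl Θ' Θ ⊎ TotalCong Θ'

  Kernel : (B : RAlgebra) → (Rel₀ U → RAlgebra.Carrier B) → Rel₀ U → Rel₀ U → Set
  Kernel B h R S = h R ≡ h S

  Pt : Rel₀ U → Set
  Pt p = InSb p × (E ⨾ p ⨾ E ≐ E) × (p ⨾ E ⨾ p ⊆ʳ Idʳ E)

  PtSq : BRel (Rel₀ U) 0ℓ
  PtSq p q = Pt p × Pt q

  σ : (B : RAlgebra) → (Rel₀ U → RAlgebra.Carrier B) → Rel₀ U → BRel (Rel₀ U) 0ℓ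
  σ B h R p q = Pt p × Pt q × h E ≡ h (E ⨾ p ⨾ R ⨾ q ⨾ E)

  -- Id ∩ (Pt_E × Pt_E)  (identity of sets = extensional equality)
  IdPt : BRel (Rel₀ U) 0ℓ
  IdPt p q = (p ≐ q) × Pt p × Pt q

-- Since the kernel of h is maximal, h(J) ∈ {h(∅), h(E)} for every ideal J (a relation
-- with E|J|E ⊆ J): "agreeing outside J" is a congruence containing the kernel, hence it is
-- either the kernel or total.  So the relations X with h(X) = h(E) form a filter that is
-- prime on ideals, and E|p|R|q|E is an ideal.  For points p, q the relation E|p|R|q|E
-- only depends on which pairs ⟨a, c⟩ with p a a and q c c satisfy R a c, and a point meets
-- every E-class exactly once; combining the two turns each Boolean and relational operation
-- on R into the corresponding operation on σ(R).  For composition, the intermediate point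
-- is chosen, in the class of each a with p a a, as a witness y of R a y continuing to q
-- along S.

module Submission where

open import Defs
open import Level using (0ℓ) renaming (suc to lsuc)
open import Data.Product using (Σ; ∃; ∃₂; _×_; _,_; proj₁; proj₂; swap)
open import Data.Sum using (_⊎_; inj₁; inj₂; [_,_]′)
import Data.Sum as Sum
import Data.Product as Product
open import Data.Empty using (⊥-elim)
open import Relation.Nullary using (¬_; yes; no)
open import Relation.Nullary.Decidable using (decidable-stable)
open import Relation.Binary.PropositionalEquality
  using (_≡_; refl; sym; trans; cong; cong₂; subst; module ≡-Reasoning)
open import Relation.Binary.Structures using (IsEquivalence)
open import Axiom.ExcludedMiddle using (ExcludedMiddle)

choose-or : ExcludedMiddle 0ℓ → {A : Set} (P : A → Set) (default : A) →
            Σ A λ y → (P y ⊎ y ≡ default) × (∃ P → P y)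
choose-or em P default with em {∃ P}
... | yes (y , py) = y , inj₁ py , λ _ → py
... | no ¬∃P       = default , inj₂ refl , λ ∃P → ⊥-elim (¬∃P ∃P)

module _ {A : Set} where

  ∪-absorbs-⊆ : {R S : Rel₀ A} → R ⊆ʳ S → R ∪ʳ S ≐ S
  ∪-absorbs-⊆ R⊆S = (λ x y → [ R⊆S x y , (λ s → s) ]′) , (λ _ _ → inj₂)

  ∖-∅ : {R : Rel₀ A} → R ∖ʳ ∅ʳ ≐ R
  ∖-∅ = (λ _ _ → proj₁) , (λ _ _ r → r , λ ())

  ∖-⊇ : {R J : Rel₀ A} → R ⊆ʳ J → R ∖ʳ J ≐ ∅ʳ
  ∖-⊇ R⊆J = (λ { x y (r , ¬j) → ¬j (R⊆J x y r) }) , (λ _ _ ())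

module Relations {U : Set} {E : Rel₀ U} (E-isEquivalence : IsEquivalence E) where
  open IsEquivalence E-isEquivalence renaming (refl to E-refl; sym to E-sym; trans to E-trans)

  ∅-InSb : InSb E ∅ʳ
  ∅-InSb _ _ ()

  E-InSb : InSb E E
  E-InSb _ _ e = e

  ∖-InSb : ∀ {R} J → InSb E R → InSb E (R ∖ʳ J)
  ∖-InSb J R⊆E x y (r , _) = R⊆E x y r

  ∪-InSb : ∀ {R S} → InSb E R → InSb E S → InSb E (R ∪ʳ S)
  ∪-InSb R⊆E S⊆E x y = [ R⊆E x y , S⊆E x y ]′

  ∩-InSb : ∀ {R} S → InSb E R → InSb E (R ∩ʳ S)
  ∩-InSb S R⊆E x y (r , _) = R⊆E x y r

  ⨾-InSb : ∀ {R S} → InSb E R → InSb E S → InSb E (R ⨾ S)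
  ⨾-InSb R⊆E S⊆E x z (y , r , s) = E-trans (R⊆E x y r) (S⊆E y z s)

  ⁻¹-InSb : ∀ {R} → InSb E R → InSb E (R ⁻¹ʳ)
  ⁻¹-InSb R⊆E x y r = E-sym (R⊆E y x r)

  record IsIdeal (J : Rel₀ U) : Set where
    field
      inSb    : InSb E J
      closedˡ : ∀ {x y z} → E x y → J y z → J x z
      closedʳ : ∀ {x y z} → J x y → E y z → J x z

    symmetric : ∀ {x y} → J x y → J y x
    symmetric {x} {y} j = closedʳ (closedˡ (E-sym (inSb x y j)) j) (E-sym (inSb x y j))

  module _ {J : Rel₀ U} (J-ideal : IsIdeal J) where
    open IsIdeal J-ideal

    ideal-∖-⨾ : ∀ {R S} → InSb E R → InSb E S → (R ⨾ S) ∖ʳ J ≐ (R ∖ʳ J) ⨾ (S ∖ʳ J)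
    ideal-∖-⨾ R⊆E S⊆E =
        (λ { x z ((y , r , s) , ¬j) →
               y , (r , λ j → ¬j (closedʳ j (S⊆E y z s))) , (s , λ j → ¬j (closedˡ (R⊆E x y r) j)) })
      , (λ { x z (y , (r , ¬j) , (s , _)) → (y , r , s) , λ j → ¬j (closedʳ j (E-sym (S⊆E y z s))) })

    ideal-∖-⁻¹ : ∀ {R : Rel₀ U} → (R ⁻¹ʳ) ∖ʳ J ≐ (R ∖ʳ J) ⁻¹ʳ
    ideal-∖-⁻¹ = (λ { x y (r , ¬j) → r , λ j → ¬j (symmetric j) })
               , (λ { x y (r , ¬j) → r , λ j → ¬j (symmetric j) })

  module Point {p : Rel₀ U} (P : Pt E p) where
    private
      p⊆E : InSb E p
      p⊆E = proj₁ P

      E⊆E⨾p⨾E : E ⊆ʳ E ⨾ p ⨾ E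
      E⊆E⨾p⨾E = proj₂ (proj₁ (proj₂ P))

      p⨾E⨾p⊆Id : p ⨾ E ⨾ p ⊆ʳ Idʳ E
      p⨾E⨾p⊆Id = proj₂ (proj₂ P)

    diagonal : ∀ {a b} → p a b → a ≡ b
    diagonal {a} {b} pab = proj₁ (p⨾E⨾p⊆Id a b (a , (b , pab , E-sym (p⊆E a b pab)) , pab))

    unique : ∀ {a a'} → p a a → p a' a' → E a a' → a ≡ a'
    unique {a} {a'} paa pa'a' e = proj₁ (p⨾E⨾p⊆Id a a' (a' , (a , paa , e) , pa'a'))

    meets : ∀ x → ∃ λ a → E x a × p a a
    meets x with E⊆E⨾p⨾E x x E-refl
    ... | _ , (a , exa , paw) , _ with diagonal paw
    ...   | refl = a , exa , paw

  open Point

  Sandwich : Rel₀ U → Rel₀ U → Rel₀ U → Rel₀ U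
  Sandwich p R q = E ⨾ p ⨾ R ⨾ q ⨾ E

  sandwich-intro : ∀ {p R q x a c z} → E x a → p a a → R a c → q c c → E c z → Sandwich p R q x z
  sandwich-intro {a = a} {c = c} exa paa rac qcc ecz = c , (c , (a , (a , exa , paa) , rac) , qcc) , ecz

  sandwich-elim : ∀ {p R q x z} → Pt E p → Pt E q → Sandwich p R q x z →
                  ∃₂ λ a c → E x a × p a a × R a c × q c c × E c z
  sandwich-elim P Q (w , (c , (b , (a , exa , pab) , rbc) , qcw) , ewz)
    with diagonal P pab | diagonal Q qcw
  ... | refl | refl = a , c , exa , pab , rbc , qcw , ewz

  module _ {p q : Rel₀ U} where

    sandwich-InSb : ∀ {R} → Pt E p → InSb E R → Pt E q → InSb E (Sandwich p R q)
    sandwich-InSb P R⊆E Q x z (w , (c , (b , (a , exa , pab) , rbc) , qcw) , ewz) =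
      E-trans exa (E-trans (proj₁ P a b pab) (E-trans (R⊆E b c rbc) (E-trans (proj₁ Q c w qcw) ewz)))

    sandwich-isIdeal : ∀ {R} → Pt E p → InSb E R → Pt E q → IsIdeal (Sandwich p R q)
    sandwich-isIdeal P R⊆E Q = record
      { inSb    = sandwich-InSb P R⊆E Q
      ; closedˡ = λ { exy (w , (c , (b , (a , eya , pab) , rbc) , qcw) , ewz) →
                        w , (c , (b , (a , E-trans exy eya , pab) , rbc) , qcw) , ewz }
      ; closedʳ = λ { (w , t , ewy) eyz → w , t , E-trans ewy eyz }
      }

    sandwich-mono : ∀ {R S} → R ⊆ʳ S → Sandwich p R q ⊆ʳ Sandwich p S q
    sandwich-mono R⊆S x z (w , (c , (b , t , rbc) , qcw) , ewz) = w , (c , (b , t , R⊆S b c rbc) , qcw) , ewz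

    sandwich-∅ : Sandwich p ∅ʳ q ⊆ʳ ∅ʳ
    sandwich-∅ x z (_ , (_ , (_ , _ , ()) , _) , _)

    sandwich-∪ : ∀ {R S} → Sandwich p (R ∪ʳ S) q ⊆ʳ Sandwich p R q ∪ʳ Sandwich p S q
    sandwich-∪ x z (w , (c , (b , t , r∪s) , qcw) , ewz) =
      Sum.map (λ r → w , (c , (b , t , r) , qcw) , ewz) (λ s → w , (c , (b , t , s) , qcw) , ewz) r∪s

    sandwich-∩ : ∀ {R S} → Pt E p → Pt E q → Sandwich p R q ∩ʳ Sandwich p S q ⊆ʳ Sandwich p (R ∩ʳ S) q
    sandwich-∩ P Q x z (t , t') with sandwich-elim P Q t | sandwich-elim P Q t'
    ... | a , c , exa , paa , rac , qcc , ecz | a' , c' , exa' , pa'a' , sa'c' , qc'c' , ec'z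
      with unique P paa pa'a' (E-trans (E-sym exa) exa') | unique Q qcc qc'c' (E-trans ecz (E-sym ec'z))
    ... | refl | refl = sandwich-intro exa paa (rac , sa'c') qcc ecz

    sandwich-⁻¹ : ∀ {R} → Pt E p → Pt E q → Sandwich p (R ⁻¹ʳ) q ⊆ʳ (Sandwich q R p) ⁻¹ʳ
    sandwich-⁻¹ P Q x z t with sandwich-elim P Q t
    ... | a , c , exa , paa , rca , qcc , ecz = sandwich-intro (E-sym ecz) qcc rca paa (E-sym exa)

    E⊆sandwich-E : Pt E p → Pt E q → E ⊆ʳ Sandwich p E q
    E⊆sandwich-E P Q x z exz with meets P x
    ... | a , exa , paa with meets Q a
    ...   | c , eac , qcc = sandwich-intro exa paa eac qcc (E-trans (E-sym eac) (E-trans (E-sym exa) exz))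

    E⊆sandwich-Id : Pt E p → p ≐ q → E ⊆ʳ Sandwich p (Idʳ E) q
    E⊆sandwich-Id P p≐q x z exz with meets P x
    ... | a , exa , paa = sandwich-intro exa paa (refl , E-refl) (proj₁ p≐q a a paa) (E-trans (E-sym exa) exz)

  sandwich-⨾-meet : ∀ {p r q R S} → Pt E p → Pt E r → Pt E q → InSb E R →
                    Sandwich p R r ∩ʳ Sandwich r S q ⊆ʳ Sandwich p (R ⨾ S) q
  sandwich-⨾-meet P Pr Q R⊆E x z (t , t') with sandwich-elim P Pr t | sandwich-elim Pr Q t'
  ... | a , c , exa , paa , rac , rcc , ecz | a' , c' , exa' , ra'a' , sa'c' , qc'c' , ec'z
    with unique Pr rcc ra'a' (E-trans (E-sym (R⊆E a c rac)) (E-trans (E-sym exa) exa'))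
  ... | refl = sandwich-intro exa paa (c , rac , sa'c') qc'c' ec'z

  module Midpoint (em : ExcludedMiddle 0ℓ) {p q R S : Rel₀ U} (P : Pt E p) (Q : Pt E q)
                  (R⊆E : InSb E R) (S⊆E : InSb E S) where

    Continues : U → U → Set
    Continues a y = R a y × ∃ λ d → S y d × q d d

    private
      choice : ∀ a → Σ U λ y → (Continues a y ⊎ y ≡ a) × (∃ (Continues a) → Continues a y)
      choice a = choose-or em (Continues a) a

    next : U → U
    next a = proj₁ (choice a)

    E-next : ∀ a → E a (next a)
    E-next a = [ (λ c → R⊆E a (next a) (proj₁ c)) , (λ eq → subst (E a) (sym eq) E-refl) ]′
                 (proj₁ (proj₂ (choice a)))

    next-continues : ∀ {a} → ∃ (Continues a) → Continues a (next a)
    next-continues {a} = proj₂ (proj₂ (choice a))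

    midpoint : Rel₀ U
    midpoint y y' = y ≡ y' × ∃ λ a → p a a × next a ≡ y

    midpoint-Pt : Pt E midpoint
    midpoint-Pt = (λ { y _ (refl , _) → E-refl })
                , ((λ { x z (w , (y , exy , (refl , _)) , eyz) → E-trans exy eyz }) , E⊆E⨾m⨾E)
                , m⨾E⨾m⊆Id
      where
      E⊆E⨾m⨾E : E ⊆ʳ (E ⨾ midpoint ⨾ E)
      E⊆E⨾m⨾E x z exz with meets P x
      ... | a , exa , paa =
        next a , (next a , E-trans exa (E-next a) , (refl , a , paa , refl)) ,
        E-trans (E-sym (E-next a)) (E-trans (E-sym exa) exz)

      m⨾E⨾m⊆Id : midpoint ⨾ E ⨾ midpoint ⊆ʳ Idʳ E
      m⨾E⨾m⊆Id _ _ (_ , (_ , (refl , a , paa , refl) , e) , (refl , a' , pa'a' , refl)) =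
        cong next (unique P paa pa'a' (E-trans (E-next a) (E-trans e (E-sym (E-next a'))))) , e

    private
      decompose : ∀ {x z} → Sandwich p (R ⨾ S) q x z →
                  ∃₂ λ a d → E x a × p a a × R a (next a) × S (next a) d × q d d × E a z
      decompose t with sandwich-elim P Q t
      ... | a , c , exa , paa , (y , ray , syc) , qcc , ecz with next-continues (y , ray , c , syc , qcc)
      ...   | ra-next , d , s-next-d , qdd =
        a , d , exa , paa , ra-next , s-next-d , qdd ,
        E-trans (R⊆E a y ray) (E-trans (S⊆E y c syc) ecz)

    sandwich-⨾-left : Sandwich p (R ⨾ S) q ⊆ʳ Sandwich p R midpoint
    sandwich-⨾-left x z t with decompose t
    ... | a , _ , exa , paa , ra-next , _ , _ , eaz =
      sandwich-intro exa paa ra-next (refl , a , paa , refl) (E-trans (E-sym (E-next a)) eaz)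

    sandwich-⨾-right : Sandwich p (R ⨾ S) q ⊆ʳ Sandwich midpoint S q
    sandwich-⨾-right x z t with decompose t
    ... | a , d , exa , paa , _ , s-next-d , qdd , eaz =
      sandwich-intro (E-trans exa (E-next a)) (refl , a , paa , refl) s-next-d qdd
        (E-trans (E-sym (S⊆E (next a) d s-next-d)) (E-trans (E-sym (E-next a)) eaz))

module Homomorphism (em : ExcludedMiddle 0ℓ) {U : Set} {E : Rel₀ U} (E-isEquivalence : IsEquivalence E)
                    {B : RAlgebra} {h : Rel₀ U → RAlgebra.Carrier B} (hom : IsHom E B h) where
  open IsEquivalence E-isEquivalence using () renaming (sym to E-sym)
  open Relations E-isEquivalence
  open RAlgebra B
  open IsHom hom
  open ≡-Reasoning

  ¬¬-elim : {P : Set} → ¬ ¬ P → P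
  ¬¬-elim = decidable-stable em

  h-cong : ∀ {R S} → InSb E R → InSb E S → R ≐ S → h R ≡ h S
  h-cong = h-resp _ _

  h-∖ʳ : ∀ {R J} → InSb E R → InSb E J → h (R ∖ʳ J) ≡ - ((- h R) + h J)
  h-∖ʳ {R} {J} R⊆E J⊆E = begin
    h (R ∖ʳ J)               ≡⟨ h-cong (∖-InSb J R⊆E) (∖-InSb _ E-InSb) de-Morgan ⟩
    h (E ∖ʳ ((E ∖ʳ R) ∪ʳ J)) ≡⟨ h-∖ _ (∪-InSb (∖-InSb R E-InSb) J⊆E) ⟩
    - h ((E ∖ʳ R) ∪ʳ J)      ≡⟨ cong -_ (h-∪ _ _ (∖-InSb R E-InSb) J⊆E) ⟩
    - (h (E ∖ʳ R) + h J)     ≡⟨ cong (λ u → - (u + h J)) (h-∖ R R⊆E) ⟩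
    - ((- h R) + h J)        ∎
    where
    de-Morgan : R ∖ʳ J ≐ E ∖ʳ ((E ∖ʳ R) ∪ʳ J)
    de-Morgan = (λ { x y (r , ¬j) → R⊆E x y r , [ (λ { (_ , ¬r) → ¬r r }) , ¬j ]′ })
              , (λ { x y (e , ¬[¬r∪j]) → ¬¬-elim (λ ¬r → ¬[¬r∪j] (inj₁ (e , ¬r))) , (λ j → ¬[¬r∪j] (inj₂ j)) })

  h-∩ : ∀ {R S} → InSb E R → InSb E S → h (R ∩ʳ S) ≡ - ((- h R) + (- h S))
  h-∩ {R} {S} R⊆E S⊆E = begin
    h (R ∩ʳ S)           ≡⟨ h-cong (∩-InSb S R⊆E) (∖-InSb _ R⊆E) ∩≐∖∖ ⟩
    h (R ∖ʳ (E ∖ʳ S))    ≡⟨ h-∖ʳ R⊆E (∖-InSb S E-InSb) ⟩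
    - ((- h R) + h (E ∖ʳ S)) ≡⟨ cong (λ u → - ((- h R) + u)) (h-∖ S S⊆E) ⟩
    - ((- h R) + (- h S)) ∎
    where
    ∩≐∖∖ : R ∩ʳ S ≐ R ∖ʳ (E ∖ʳ S)
    ∩≐∖∖ = (λ { x y (r , s) → r , λ { (_ , ¬s) → ¬s s } })
         , (λ { x y (r , ¬[e∖s]) → r , ¬¬-elim (λ ¬s → ¬[e∖s] (R⊆E x y r , ¬s)) })

  h-E≡h-∅⇒h≡h-∅ : h E ≡ h ∅ʳ → ∀ X → InSb E X → h X ≡ h ∅ʳ
  h-E≡h-∅⇒h≡h-∅ hE≡h∅ X X⊆E = begin
    h X                  ≡⟨ h-cong X⊆E (∖-InSb ∅ʳ X⊆E) (swap ∖-∅) ⟩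
    h (X ∖ʳ ∅ʳ)          ≡⟨ h-∖ʳ X⊆E ∅-InSb ⟩
    - ((- h X) + h ∅ʳ)   ≡⟨ cong (λ u → - ((- h X) + u)) (sym hE≡h∅) ⟩
    - ((- h X) + h E)    ≡⟨ sym (h-∖ʳ X⊆E E-InSb) ⟩
    h (X ∖ʳ E)           ≡⟨ h-cong (∖-InSb E X⊆E) ∅-InSb (∖-⊇ X⊆E) ⟩
    h ∅ʳ                 ∎

  -- Oriented as in σ, so that σ E B h R p q is literally Pt p × Pt q × InFilter (Sandwich p R q).
  InFilter : Rel₀ U → Set
  InFilter X = h E ≡ h X

  InFilter-mono : ∀ {X Y} → InSb E Y → X ⊆ʳ Y → InFilter X → InFilter Y
  InFilter-mono {X} {Y} Y⊆E X⊆Y hE≡hX = begin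
    h E         ≡⟨ h-cong E-InSb (∪-InSb Y⊆E E-InSb) (swap (∪-absorbs-⊆ Y⊆E)) ⟩
    h (Y ∪ʳ E)  ≡⟨ h-∪ Y E Y⊆E E-InSb ⟩
    h Y + h E   ≡⟨ cong (h Y +_) hE≡hX ⟩
    h Y + h X   ≡⟨ sym (h-∪ Y X Y⊆E X⊆E) ⟩
    h (Y ∪ʳ X)  ≡⟨ h-cong (∪-InSb Y⊆E X⊆E) Y⊆E Y∪X≐Y ⟩
    h Y         ∎
    where
    X⊆E : InSb E X
    X⊆E x y r = Y⊆E x y (X⊆Y x y r)

    Y∪X≐Y : Y ∪ʳ X ≐ Y
    Y∪X≐Y = (λ x y → [ (λ r → r) , X⊆Y x y ]′) , (λ _ _ → inj₁)

  InFilter-∩ : ∀ {X Y} → InSb E X → InSb E Y → InFilter X → InFilter Y → InFilter (X ∩ʳ Y)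
  InFilter-∩ {X} {Y} X⊆E Y⊆E hE≡hX hE≡hY = begin
    h E                   ≡⟨ h-cong E-InSb (∩-InSb E E-InSb) ((λ _ _ e → e , e) , (λ _ _ → proj₁)) ⟩
    h (E ∩ʳ E)            ≡⟨ h-∩ E-InSb E-InSb ⟩
    - ((- h E) + (- h E)) ≡⟨ cong₂ (λ u v → - ((- u) + (- v))) hE≡hX hE≡hY ⟩
    - ((- h X) + (- h Y)) ≡⟨ sym (h-∩ X⊆E Y⊆E) ⟩
    h (X ∩ʳ Y)            ∎

  InFilter-⁻¹ : ∀ {X} → InSb E X → InFilter X → InFilter (X ⁻¹ʳ)
  InFilter-⁻¹ {X} X⊆E hE≡hX = begin
    h E        ≡⟨ h-cong E-InSb (⁻¹-InSb E-InSb) ((λ _ _ → E-sym) , (λ _ _ → E-sym)) ⟩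
    h (E ⁻¹ʳ)  ≡⟨ h-⁻¹ E E-InSb ⟩
    h E ˘      ≡⟨ cong _˘ hE≡hX ⟩
    h X ˘      ≡⟨ sym (h-⁻¹ X X⊆E) ⟩
    h (X ⁻¹ʳ)  ∎

module MaximalKernel (em : ExcludedMiddle 0ℓ) {U : Set} {E : Rel₀ U} (E-isEquivalence : IsEquivalence E)
                     {B : RAlgebra} (nondegenerate : Nondegenerate B) {h : Rel₀ U → RAlgebra.Carrier B}
                     (hom : IsHom E B h) (surjective : Surjective E B h)
                     (maximal : IsMaximalCongruence E (Kernel E B h)) where
  open Relations E-isEquivalence
  open Homomorphism em E-isEquivalence hom
  open RAlgebra B
  open IsHom hom
  open IsMaximalCongruence maximal using () renaming (maximal to kernel-maximal)
  open ≡-Reasoning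

  ¬InFilter-∅ : ¬ InFilter ∅ʳ
  ¬InFilter-∅ hE≡h∅ =
    let b , b' , b≢b' = nondegenerate in b≢b' (trans (collapse b) (sym (collapse b')))
    where
    collapse : ∀ b → b ≡ h ∅ʳ
    collapse b = let X , X⊆E , hX≡b = surjective b in trans (sym hX≡b) (h-E≡h-∅⇒h≡h-∅ hE≡h∅ X X⊆E)

  -- R ≈ S says that R and S agree outside J.  This congruence contains the kernel, so by
  -- maximality it is the kernel (and then J ≈ ∅) or it is total (and then E ≈ ∅).
  module ModuloIdeal {J : Rel₀ U} (J-ideal : IsIdeal J) where
    open IsIdeal J-ideal renaming (inSb to J⊆E)

    _≈_ : Rel₀ U → Rel₀ U → Set
    R ≈ S = h (R ∖ʳ J) ≡ h (S ∖ʳ J)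

    h-∖J-∪ : ∀ {R S} → InSb E R → InSb E S → h ((R ∪ʳ S) ∖ʳ J) ≡ h (R ∖ʳ J) + h (S ∖ʳ J)
    h-∖J-∪ {R} {S} R⊆E S⊆E = trans
      (h-cong (∖-InSb J (∪-InSb R⊆E S⊆E)) (∪-InSb (∖-InSb J R⊆E) (∖-InSb J S⊆E)) ∖-distrib-∪)
      (h-∪ _ _ (∖-InSb J R⊆E) (∖-InSb J S⊆E))
      where
      ∖-distrib-∪ : (R ∪ʳ S) ∖ʳ J ≐ (R ∖ʳ J) ∪ʳ (S ∖ʳ J)
      ∖-distrib-∪ = (λ { x y (r∪s , ¬j) → Sum.map (_, ¬j) (_, ¬j) r∪s })
                  , (λ x y → [ Product.map₁ inj₁ , Product.map₁ inj₂ ]′)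

    h-∖J-complement : ∀ {R} → InSb E R → h ((E ∖ʳ R) ∖ʳ J) ≡ - (h (R ∖ʳ J) + h J)
    h-∖J-complement {R} R⊆E = begin
      h ((E ∖ʳ R) ∖ʳ J)           ≡⟨ h-cong (∖-InSb J (∖-InSb R E-InSb)) (∖-InSb _ E-InSb) de-Morgan ⟩
      h (E ∖ʳ ((R ∖ʳ J) ∪ʳ J))    ≡⟨ h-∖ _ (∪-InSb (∖-InSb J R⊆E) J⊆E) ⟩
      - h ((R ∖ʳ J) ∪ʳ J)         ≡⟨ cong -_ (h-∪ _ _ (∖-InSb J R⊆E) J⊆E) ⟩
      - (h (R ∖ʳ J) + h J)        ∎
      where
      de-Morgan : (E ∖ʳ R) ∖ʳ J ≐ E ∖ʳ ((R ∖ʳ J) ∪ʳ J)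
      de-Morgan = (λ { x y ((e , ¬r) , ¬j) → e , [ (λ { (r , _) → ¬r r }) , ¬j ]′ })
                , (λ { x y (e , ¬[r∖j∪j]) → let ¬j = λ j → ¬[r∖j∪j] (inj₂ j) in
                                            (e , λ r → ¬[r∖j∪j] (inj₁ (r , ¬j))) , ¬j })

    h-∖J-⨾ : ∀ {R S} → InSb E R → InSb E S → h ((R ⨾ S) ∖ʳ J) ≡ h (R ∖ʳ J) ︔ h (S ∖ʳ J)
    h-∖J-⨾ R⊆E S⊆E = trans
      (h-cong (∖-InSb J (⨾-InSb R⊆E S⊆E)) (⨾-InSb (∖-InSb J R⊆E) (∖-InSb J S⊆E))
              (ideal-∖-⨾ J-ideal R⊆E S⊆E))
      (h-⨾ _ _ (∖-InSb J R⊆E) (∖-InSb J S⊆E))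

    h-∖J-⁻¹ : ∀ {R} → InSb E R → h ((R ⁻¹ʳ) ∖ʳ J) ≡ h (R ∖ʳ J) ˘
    h-∖J-⁻¹ R⊆E = trans
      (h-cong (∖-InSb J (⁻¹-InSb R⊆E)) (⁻¹-InSb (∖-InSb J R⊆E)) (ideal-∖-⁻¹ J-ideal))
      (h-⁻¹ _ (∖-InSb J R⊆E))

    ≈-isCongruence : IsCongruence E _≈_
    ≈-isCongruence = record
      { Θ-refl  = λ R S R⊆E S⊆E R≐S → h-cong (∖-InSb J R⊆E) (∖-InSb J S⊆E)
                    ( (λ { x y (r , ¬j) → proj₁ R≐S x y r , ¬j })
                    , (λ { x y (s , ¬j) → proj₂ R≐S x y s , ¬j }))
      ; Θ-sym   = λ _ _ _ _ → sym
      ; Θ-trans = λ _ _ _ _ _ _ → trans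
      ; Θ-∪     = λ R R' S S' R⊆E R'⊆E S⊆E S'⊆E R≈R' S≈S' → begin
          h ((R ∪ʳ S) ∖ʳ J)          ≡⟨ h-∖J-∪ R⊆E S⊆E ⟩
          h (R ∖ʳ J) + h (S ∖ʳ J)    ≡⟨ cong₂ _+_ R≈R' S≈S' ⟩
          h (R' ∖ʳ J) + h (S' ∖ʳ J)  ≡⟨ sym (h-∖J-∪ R'⊆E S'⊆E) ⟩
          h ((R' ∪ʳ S') ∖ʳ J)        ∎
      ; Θ-∖     = λ R R' R⊆E R'⊆E R≈R' → begin
          h ((E ∖ʳ R) ∖ʳ J)          ≡⟨ h-∖J-complement R⊆E ⟩
          - (h (R ∖ʳ J) + h J)       ≡⟨ cong (λ u → - (u + h J)) R≈R' ⟩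
          - (h (R' ∖ʳ J) + h J)      ≡⟨ sym (h-∖J-complement R'⊆E) ⟩
          h ((E ∖ʳ R') ∖ʳ J)         ∎
      ; Θ-⨾     = λ R R' S S' R⊆E R'⊆E S⊆E S'⊆E R≈R' S≈S' → begin
          h ((R ⨾ S) ∖ʳ J)           ≡⟨ h-∖J-⨾ R⊆E S⊆E ⟩
          h (R ∖ʳ J) ︔ h (S ∖ʳ J)    ≡⟨ cong₂ _︔_ R≈R' S≈S' ⟩
          h (R' ∖ʳ J) ︔ h (S' ∖ʳ J)  ≡⟨ sym (h-∖J-⨾ R'⊆E S'⊆E) ⟩
          h ((R' ⨾ S') ∖ʳ J)         ∎
      ; Θ-⁻¹    = λ R R' R⊆E R'⊆E R≈R' → begin
          h ((R ⁻¹ʳ) ∖ʳ J)           ≡⟨ h-∖J-⁻¹ R⊆E ⟩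
          h (R ∖ʳ J) ˘               ≡⟨ cong _˘ R≈R' ⟩
          h (R' ∖ʳ J) ˘              ≡⟨ sym (h-∖J-⁻¹ R'⊆E) ⟩
          h ((R' ⁻¹ʳ) ∖ʳ J)          ∎
      }

    kernel⊆≈ : CongIncl E (Kernel E B h) _≈_
    kernel⊆≈ R S R⊆E S⊆E hR≡hS = begin
      h (R ∖ʳ J)         ≡⟨ h-∖ʳ R⊆E J⊆E ⟩
      - ((- h R) + h J)  ≡⟨ cong (λ u → - ((- u) + h J)) hR≡hS ⟩
      - ((- h S) + h J)  ≡⟨ sym (h-∖ʳ S⊆E J⊆E) ⟩
      h (S ∖ʳ J)         ∎

    ∅∖J≡∅ : h (∅ʳ ∖ʳ J) ≡ h ∅ʳ
    ∅∖J≡∅ = h-cong (∖-InSb J ∅-InSb) ∅-InSb (∖-⊇ λ _ _ ())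

    J≈∅ : J ≈ ∅ʳ
    J≈∅ = trans (h-cong (∖-InSb J J⊆E) ∅-InSb (∖-⊇ λ _ _ j → j)) (sym ∅∖J≡∅)

    E≈∅⇒InFilter-J : E ≈ ∅ʳ → InFilter J
    E≈∅⇒InFilter-J E≈∅ = begin
      h E                ≡⟨ h-cong E-InSb (∖-InSb ∅ʳ E-InSb) (swap ∖-∅) ⟩
      h (E ∖ʳ ∅ʳ)        ≡⟨ h-∖ ∅ʳ ∅-InSb ⟩
      - h ∅ʳ             ≡⟨ cong -_ (sym ∅∖J≡∅) ⟩
      - h (∅ʳ ∖ʳ J)      ≡⟨ cong -_ (sym E≈∅) ⟩
      - h (E ∖ʳ J)       ≡⟨ sym (h-∖ _ (∖-InSb J E-InSb)) ⟩
      h (E ∖ʳ (E ∖ʳ J))  ≡⟨ h-cong (∖-InSb _ E-InSb) J⊆E complement-involutive ⟩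
      h J                ∎
      where
      complement-involutive : E ∖ʳ (E ∖ʳ J) ≐ J
      complement-involutive = (λ { x y (e , ¬[e∖j]) → ¬¬-elim (λ ¬j → ¬[e∖j] (e , ¬j)) })
                            , (λ x y j → J⊆E x y j , (λ { (_ , ¬j) → ¬j j }))

    dichotomy : h J ≡ h ∅ʳ ⊎ InFilter J
    dichotomy = Sum.map (λ ≈⊆kernel → ≈⊆kernel J ∅ʳ J⊆E ∅-InSb J≈∅)
                        (λ ≈-total → E≈∅⇒InFilter-J (≈-total E ∅ʳ E-InSb ∅-InSb))
                        (kernel-maximal _≈_ ≈-isCongruence kernel⊆≈)

  ideal-dichotomy : ∀ {J} → IsIdeal J → h J ≡ h ∅ʳ ⊎ InFilter J
  ideal-dichotomy J-ideal = ModuloIdeal.dichotomy J-ideal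

  InFilter-∪-prime : ∀ {J K} → IsIdeal J → InSb E K → InFilter (J ∪ʳ K) → InFilter J ⊎ InFilter K
  InFilter-∪-prime {J} {K} J-ideal K⊆E hE≡hJ∪K with ideal-dichotomy J-ideal
  ... | inj₂ J-in = inj₁ J-in
  ... | inj₁ hJ≡h∅ = inj₂ (begin
    h E            ≡⟨ hE≡hJ∪K ⟩
    h (J ∪ʳ K)     ≡⟨ h-∪ J K (IsIdeal.inSb J-ideal) K⊆E ⟩
    h J + h K      ≡⟨ cong (_+ h K) hJ≡h∅ ⟩
    h ∅ʳ + h K     ≡⟨ sym (h-∪ ∅ʳ K ∅-InSb K⊆E) ⟩
    h (∅ʳ ∪ʳ K)    ≡⟨ h-cong (∪-InSb ∅-InSb K⊆E) K⊆E (∪-absorbs-⊆ λ _ _ ()) ⟩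
    h K            ∎)

  σₕ : Rel₀ U → BRel (Rel₀ U) 0ℓ
  σₕ = σ E B h

  σ⊆PtSq : ∀ {R} → σₕ R ⊆ʳ PtSq E
  σ⊆PtSq p q (P , Q , _) = P , Q

  σ-mono : ∀ {R S} → InSb E S → R ⊆ʳ S → σₕ R ⊆ʳ σₕ S
  σ-mono S⊆E R⊆S p q (P , Q , R-in) = P , Q , InFilter-mono (sandwich-InSb P S⊆E Q) (sandwich-mono R⊆S) R-in

  σ-∅ : σₕ ∅ʳ ≐ ∅ʳ
  σ-∅ = (λ { p q (P , Q , ∅-in) → ¬InFilter-∅ (InFilter-mono ∅-InSb sandwich-∅ ∅-in) }) , (λ _ _ ())

  σ-E : σₕ E ≐ PtSq E
  σ-E = σ⊆PtSq
      , (λ { p q (P , Q) → P , Q , InFilter-mono (sandwich-InSb P E-InSb Q) (E⊆sandwich-E P Q) refl })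

  σ-∪ : ∀ {R S} → InSb E R → InSb E S → σₕ (R ∪ʳ S) ≐ σₕ R ∪ʳ σₕ S
  σ-∪ {R} {S} R⊆E S⊆E =
    split , (λ p q → [ σ-mono R∪S⊆E (λ _ _ → inj₁) p q , σ-mono R∪S⊆E (λ _ _ → inj₂) p q ]′)
    where
    R∪S⊆E : InSb E (R ∪ʳ S)
    R∪S⊆E = ∪-InSb R⊆E S⊆E

    split : σₕ (R ∪ʳ S) ⊆ʳ σₕ R ∪ʳ σₕ S
    split p q (P , Q , R∪S-in) =
      Sum.map (λ R-in → P , Q , R-in) (λ S-in → P , Q , S-in)
        (InFilter-∪-prime (sandwich-isIdeal P R⊆E Q) (sandwich-InSb P S⊆E Q)
          (InFilter-mono (∪-InSb (sandwich-InSb P R⊆E Q) (sandwich-InSb P S⊆E Q)) sandwich-∪ R∪S-in))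

  σ-∩ : ∀ {R S} → InSb E R → InSb E S → σₕ R ∩ʳ σₕ S ⊆ʳ σₕ (R ∩ʳ S)
  σ-∩ {S = S} R⊆E S⊆E p q ((P , Q , R-in) , (_ , _ , S-in)) =
    P , Q , InFilter-mono (sandwich-InSb P (∩-InSb S R⊆E) Q) (sandwich-∩ P Q)
              (InFilter-∩ (sandwich-InSb P R⊆E Q) (sandwich-InSb P S⊆E Q) R-in S-in)

  σ-∖-disjoint : ∀ {R} → InSb E R → σₕ (E ∖ʳ R) ∩ʳ σₕ R ≐ ∅ʳ
  σ-∖-disjoint {R} R⊆E =
      (λ p q both → proj₁ σ-∅ p q
         (σ-mono ∅-InSb (λ { _ _ ((_ , ¬r) , r) → ¬r r }) p q (σ-∩ (∖-InSb R E-InSb) R⊆E p q both)))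
    , (λ _ _ ())

  σ-∖-cover : ∀ {R} → InSb E R → σₕ (E ∖ʳ R) ∪ʳ σₕ R ≐ PtSq E
  σ-∖-cover {R} R⊆E =
      (λ p q → [ σ⊆PtSq p q , σ⊆PtSq p q ]′)
    , (λ p q PQ → proj₁ (σ-∪ (∖-InSb R E-InSb) R⊆E) p q
         (σ-mono (∪-InSb (∖-InSb R E-InSb) R⊆E) E⊆∖∪ p q (proj₂ σ-E p q PQ)))
    where
    E⊆∖∪ : E ⊆ʳ (E ∖ʳ R) ∪ʳ R
    E⊆∖∪ x y e with em {R x y}
    ... | yes r = inj₂ r
    ... | no ¬r = inj₁ (e , ¬r)

  σ-∖ : ∀ {R} → InSb E R → σₕ (E ∖ʳ R) ≐ σₕ E ∖ʳ σₕ R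
  σ-∖ R⊆E =
      (λ p q ∁R-in → proj₂ σ-E p q (σ⊆PtSq p q ∁R-in)
                   , (λ R-in → proj₁ (σ-∖-disjoint R⊆E) p q (∁R-in , R-in)))
    , (λ { p q (E-in , ¬R-in) →
             [ (λ ∁R-in → ∁R-in) , (λ R-in → ⊥-elim (¬R-in R-in)) ]′
               (proj₂ (σ-∖-cover R⊆E) p q (σ⊆PtSq p q E-in)) })

  σ-⨾ : ∀ {R S} → InSb E R → InSb E S → σₕ (R ⨾ S) ≐ σₕ R ⨾ σₕ S
  σ-⨾ {R} {S} R⊆E S⊆E = split , join
    where
    split : σₕ (R ⨾ S) ⊆ʳ σₕ R ⨾ σₕ S
    split p q (P , Q , R⨾S-in) =
      midpoint , (P , midpoint-Pt , InFilter-mono (sandwich-InSb P R⊆E midpoint-Pt) sandwich-⨾-left R⨾S-in)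
               , (midpoint-Pt , Q , InFilter-mono (sandwich-InSb midpoint-Pt S⊆E Q) sandwich-⨾-right R⨾S-in)
      where open Midpoint em P Q R⊆E S⊆E

    join : σₕ R ⨾ σₕ S ⊆ʳ σₕ (R ⨾ S)
    join p q (r , (P , Pr , R-in) , (_ , Q , S-in)) =
      P , Q , InFilter-mono (sandwich-InSb P (⨾-InSb R⊆E S⊆E) Q) (sandwich-⨾-meet P Pr Q R⊆E)
                (InFilter-∩ (sandwich-InSb P R⊆E Pr) (sandwich-InSb Pr S⊆E Q) R-in S-in)

  σ-⁻¹-⊆ : ∀ {R} → InSb E R → σₕ (R ⁻¹ʳ) ⊆ʳ (σₕ R) ⁻¹ʳ
  σ-⁻¹-⊆ {R} R⊆E p q (P , Q , R⁻¹-in) =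
    Q , P , InFilter-⁻¹ qRp⁻¹⊆E (InFilter-mono qRp⁻¹⊆E (sandwich-⁻¹ P Q) R⁻¹-in)
    where
    qRp⁻¹⊆E : InSb E ((Sandwich q R p) ⁻¹ʳ)
    qRp⁻¹⊆E = ⁻¹-InSb (sandwich-InSb Q R⊆E P)

  -- (R ⁻¹ʳ) ⁻¹ʳ is R up to η, so the reverse inclusion is σ-⁻¹-⊆ at R ⁻¹ʳ.
  σ-⁻¹ : ∀ {R} → InSb E R → σₕ (R ⁻¹ʳ) ≐ (σₕ R) ⁻¹ʳ
  σ-⁻¹ R⊆E = σ-⁻¹-⊆ R⊆E , (λ p q → σ-⁻¹-⊆ (⁻¹-InSb R⊆E) q p)

  σ-Id : IdPt E ⊆ʳ σₕ (Idʳ E)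
  σ-Id p q (p≐q , P , Q) = P , Q , InFilter-mono (sandwich-InSb P (λ _ _ → proj₂) Q) (E⊆sandwich-Id P p≐q) refl

lemma3p2p7 : ExcludedMiddle 0ℓ → ExcludedMiddle (lsuc 0ℓ) →
    {U : Set} (E : Rel₀ U) → IsEquivalence E → (∃₂ λ x y → E x y) →
    (B : RAlgebra) → Nondegenerate B →
    (h : Rel₀ U → RAlgebra.Carrier B) → IsHom E B h → Surjective E B h →
    IsMaximalCongruence E (Kernel E B h) →
    ∀ R S → InSb E R → InSb E S →
      (σ E B h ∅ʳ ≐ ∅ʳ)
      × (σ E B h E ≐ PtSq E)
      × (R ⊆ʳ S → σ E B h R ⊆ʳ σ E B h S)
      × (σ E B h (R ∪ʳ S) ≐ σ E B h R ∪ʳ σ E B h S)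
      × (σ E B h (E ∖ʳ R) ∩ʳ σ E B h R ≐ ∅ʳ)
      × (σ E B h (E ∖ʳ R) ∪ʳ σ E B h R ≐ PtSq E)
      × (σ E B h (E ∖ʳ R) ≐ σ E B h E ∖ʳ σ E B h R)
      × (σ E B h (R ⨾ S) ≐ σ E B h R ⨾ σ E B h S)
      × (σ E B h (R ⁻¹ʳ) ≐ (σ E B h R) ⁻¹ʳ)
      × (IdPt E ⊆ʳ σ E B h (Idʳ E))
lemma3p2p7 em _ E E-isEquivalence _ B nondegenerate h hom surjective maximal R S R⊆E S⊆E =
    σ-∅ , σ-E , σ-mono S⊆E , σ-∪ R⊆E S⊆E , σ-∖-disjoint R⊆E , σ-∖-cover R⊆E , σ-∖ R⊆E
  , σ-⨾ R⊆E S⊆E , σ-⁻¹ R⊆E , σ-Id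
  where open MaximalKernel em E-isEquivalence nondegenerate hom surjective maximal
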